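{- The graph $P_2\times K_5$ has a $(8;p,q)$-decomposition.
   Context: $P_k$ denotes a path of length $k$ (with $k$ edges, $k+1$ vertices), so $P_2$ is the path on $3$ vertices; $C_k$ denotes a cycle with $k$ edges; $K_n$ is the complete graph on $n$ vertices. The tensor product $G\times H$ has vertex set $V(G)\times V(H)$, with $(g_1,h_1)(g_2,h_2)$ an edge whenever $g_1g_2\in E(G)$ and $h_1h_2\in E(H)$. A graph $G$ has a $(8;p,q)$-decomposition if, for some nonnegative integers $p,q$ with $8(p+q)=|E(G)|$, the edge set of $G$ can be partitioned into $p$ copies of $P_8$ and $q$ copies of $C_8$. -}

module Defs where

open import Data.Nat using (ℕ; zero; suc; _+_; _*_; _∸_; _<ᵇ_; NonZero)
open import Data.Nat.DivMod using (_mod_)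
open import Data.Bool using (Bool; true; false; _∧_; not; if_then_else_)
open import Data.Fin using (Fin; toℕ; inject₁; remQuot; combine)
open import Data.Fin.Properties using (_≟_)
open import Data.List using (List; map; allFin)
open import Data.Nat.ListAction using (sum)
open import Data.Product using (Σ; ∃; _×_; _,_; proj₁; proj₂)
open import Data.Sum using (_⊎_)
open import Relation.Nullary.Decidable using (⌊_⌋)
open import Relation.Binary.PropositionalEquality using (_≡_)
open import Function.Definitions using (Injective)

record Graph : Set where
  field
    order : ℕ
    adj   : Fin order → Fin order → Bool
open Graph public

dist : ℕ → ℕ → ℕ
dist a b = (a ∸ b) + (b ∸ a)

-- P_k : path with k edges on k+1 vertices 0,1,...,k
Path : ℕ → Graph
Path k = record { order = suc k ; adj = λ i j → ⌊ Data.Nat._≟_ (dist (toℕ i) (toℕ j)) 1 ⌋ }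

Complete : ℕ → Graph
Complete n = record { order = n ; adj = λ i j → not ⌊ i ≟ j ⌋ }

-- Tensor product G × H, vertex (g,h) encoded as combine g h : Fin (|G| * |H|)
_⊗_ : Graph → Graph → Graph
G ⊗ H = record
  { order = order G * order H
  ; adj   = λ x y → let (g₁ , h₁) = remQuot (order H) x
                        (g₂ , h₂) = remQuot (order H) y
                    in adj G g₁ g₂ ∧ adj H h₁ h₂
  }

edgeCount : Graph → ℕ
edgeCount G = sum (map (λ i → sum (map (λ j →
  if (toℕ i <ᵇ toℕ j) ∧ adj G i j then 1 else 0) (allFin (order G)))) (allFin (order G)))

record PathCopy (k : ℕ) (G : Graph) : Set where
  field
    vtx   : Fin (suc k) → Fin (order G)
    inj   : Injective _≡_ _≡_ vtx
    edges : ∀ (i : Fin k) → adj G (vtx (inject₁ i)) (vtx (Fin.suc i)) ≡ true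
open PathCopy public

cycNext : ∀ {k} .{{_ : NonZero k}} → Fin k → Fin k
cycNext {k} i = suc (toℕ i) mod k

record CycleCopy (k : ℕ) .{{_ : NonZero k}} (G : Graph) : Set where
  field
    vtx   : Fin k → Fin (order G)
    inj   : Injective _≡_ _≡_ vtx
    edges : ∀ (i : Fin k) → adj G (vtx i) (vtx (cycNext i)) ≡ true
open CycleCopy public

PathHasEdge : ∀ {k G} → PathCopy k G → Fin (order G) → Fin (order G) → Set
PathHasEdge {k} P u v = ∃ λ (i : Fin k) →
  (PathCopy.vtx P (inject₁ i) ≡ u × PathCopy.vtx P (Fin.suc i) ≡ v)
  ⊎ (PathCopy.vtx P (inject₁ i) ≡ v × PathCopy.vtx P (Fin.suc i) ≡ u)

CycleHasEdge : ∀ {k} .{{_ : NonZero k}} {G} → CycleCopy k G → Fin (order G) → Fin (order G) → Set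
CycleHasEdge {k} C u v = ∃ λ (i : Fin k) →
  (CycleCopy.vtx C i ≡ u × CycleCopy.vtx C (cycNext i) ≡ v)
  ⊎ (CycleCopy.vtx C i ≡ v × CycleCopy.vtx C (cycNext i) ≡ u)

record Decomposition (k : ℕ) .{{_ : NonZero k}} (G : Graph) (p q : ℕ) : Set where
  field
    paths     : Fin p → PathCopy k G
    cycles    : Fin q → CycleCopy k G
    size      : k * (p + q) ≡ edgeCount G
    partition : ∀ (u v : Fin (order G)) → adj G u v ≡ true →
      let Has : Fin p ⊎ Fin q → Set
          Has = Data.Sum.[ (λ a → PathHasEdge (paths a) u v)
                         , (λ b → CycleHasEdge (cycles b) u v) ]
      in Σ (Fin p ⊎ Fin q) λ c → Has c × (∀ c' → Has c' → c' ≡ c)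

HasDecomposition : (k : ℕ) .{{_ : NonZero k}} → Graph → Set
HasDecomposition k G = Σ ℕ λ p → Σ ℕ λ q → Decomposition k G p q

-- P₂ × K₅ has 2 · 2 · 10 = 40 edges, so five copies of P₈ can suffice.  The
-- five paths below zig-zag between the middle layer {1} × K₅ and the outer
-- layers {0,2} × K₅; that they are paths of the graph and cover every edge
-- exactly once is a finite check, done by evaluating decision procedures.
module Submission where

open import Defs
open import Agda.Builtin.FromNat using (Number; fromNat)
open import Data.Bool using (true)
import Data.Bool.Properties as Bool
open import Data.Fin using (Fin; suc; inject₁; combine)
open import Data.Fin.Properties using (_≟_; all?; any?)
import Data.Fin.Literals
open import Data.Nat using (ℕ; _*_; NonZero)
import Data.Nat.Literals
import Data.Nat as ℕ
open import Data.Nat.Properties using (+-identityʳ)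
open import Data.Product using (∃; _×_; _,_)
open import Data.Unit using (⊤; tt)
open import Data.Sum using (inj₁; inj₂)
open import Data.Vec using (Vec; _∷_; []; lookup)
open import Function.Definitions using (Injective)
open import Relation.Nullary.Decidable
  using (Dec; True; toWitness; from-yes; map′; _×-dec_; _⊎-dec_; _→-dec_)
open import Relation.Binary.PropositionalEquality using (_≡_; refl; sym; cong; subst)

instance
  finNumber : ∀ {n} → Number (Fin n)
  finNumber = Data.Fin.Literals.number _

  natNumber : Number ℕ
  natNumber = Data.Nat.Literals.number

  trivialConstraint : ⊤
  trivialConstraint = tt

injective? : ∀ {m n} (f : Fin m → Fin n) → Dec (Injective _≡_ _≡_ f)
injective? f = map′ (λ inj {x} {y} → inj x y) (λ inj x y → inj {x} {y})
  (all? λ x → all? λ y → (f x ≟ f y) →-dec (x ≟ y))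

module _ {k : ℕ} {G : Graph} where

  EdgesAlong : (Fin (ℕ.suc k) → Fin (order G)) → Set
  EdgesAlong w = ∀ i → adj G (w (inject₁ i)) (w (suc i)) ≡ true

  edgesAlong? : (w : Fin (ℕ.suc k) → Fin (order G)) → Dec (EdgesAlong w)
  edgesAlong? w = all? λ i → adj G (w (inject₁ i)) (w (suc i)) Bool.≟ true

  IsPath : (Fin (ℕ.suc k) → Fin (order G)) → Set
  IsPath w = Injective _≡_ _≡_ w × EdgesAlong w

  isPath? : (w : Fin (ℕ.suc k) → Fin (order G)) → Dec (IsPath w)
  isPath? w = injective? w ×-dec edgesAlong? w

  pathCopies : ∀ {p} (ws : Fin p → Fin (ℕ.suc k) → Fin (order G)) →
               True (all? λ a → isPath? (ws a)) → Fin p → PathCopy k G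
  pathCopies ws arePaths a = let (inj , edges) = toWitness arePaths a in
    record { vtx = ws a ; inj = inj ; edges = edges }

  pathHasEdge? : (P : PathCopy k G) (u v : Fin (order G)) → Dec (PathHasEdge P u v)
  pathHasEdge? P u v = any? λ i →
      (x i ≟ u ×-dec y i ≟ v) ⊎-dec (x i ≟ v ×-dec y i ≟ u)
    where
    x y : Fin k → Fin (order G)
    x i = PathCopy.vtx P (inject₁ i)
    y i = PathCopy.vtx P (suc i)

  UniquelyCovered : ∀ {p} → (Fin p → PathCopy k G) → (u v : Fin (order G)) → Set
  UniquelyCovered paths u v =
    ∃ (λ a → PathHasEdge (paths a) u v) ×
    (∀ a b → PathHasEdge (paths a) u v → PathHasEdge (paths b) u v → a ≡ b)

  EdgesUniquelyCovered : ∀ {p} → (Fin p → PathCopy k G) → Set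
  EdgesUniquelyCovered paths = ∀ u v → adj G u v ≡ true → UniquelyCovered paths u v

  edgesUniquelyCovered? : ∀ {p} (paths : Fin p → PathCopy k G) →
                          Dec (EdgesUniquelyCovered paths)
  edgesUniquelyCovered? paths = all? λ u → all? λ v →
    (adj G u v Bool.≟ true) →-dec
      (any? (λ a → has a u v) ×-dec
       all? λ a → all? λ b → has a u v →-dec has b u v →-dec a ≟ b)
    where
    has : ∀ a u v → Dec (PathHasEdge (paths a) u v)
    has a = pathHasEdge? (paths a)

  pathDecomposition : ∀ {p} .{{_ : NonZero k}} (paths : Fin p → PathCopy k G) →
    k * p ≡ edgeCount G → EdgesUniquelyCovered paths → Decomposition k G p 0
  pathDecomposition {p} paths size covered = record
    { paths     = paths
    ; cycles    = λ ()
    ; size      = subst (λ n → k * n ≡ edgeCount G) (sym (+-identityʳ p)) size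
    ; partition = λ u v uv → let ((a , a∋uv) , unique) = covered u v uv in
        inj₁ a , a∋uv , λ { (inj₁ b) b∋uv → cong inj₁ (unique b a b∋uv a∋uv)
                          ; (inj₂ ()) _ }
    }

G : Graph
G = Path 2 ⊗ Complete 5

⟨_,_⟩ : Fin 3 → Fin 5 → Fin (order G)
⟨ g , h ⟩ = combine g h

zigzags : Vec (Vec (Fin (order G)) 9) 5
zigzags =
  (⟨ 0 , 0 ⟩ ∷ ⟨ 1 , 2 ⟩ ∷ ⟨ 2 , 3 ⟩ ∷ ⟨ 1 , 1 ⟩ ∷ ⟨ 0 , 4 ⟩ ∷ ⟨ 1 , 0 ⟩ ∷ ⟨ 2 , 1 ⟩ ∷ ⟨ 1 , 4 ⟩ ∷ ⟨ 0 , 1 ⟩ ∷ []) ∷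
  (⟨ 0 , 1 ⟩ ∷ ⟨ 1 , 0 ⟩ ∷ ⟨ 0 , 2 ⟩ ∷ ⟨ 1 , 4 ⟩ ∷ ⟨ 0 , 3 ⟩ ∷ ⟨ 1 , 1 ⟩ ∷ ⟨ 0 , 0 ⟩ ∷ ⟨ 1 , 3 ⟩ ∷ ⟨ 2 , 4 ⟩ ∷ []) ∷
  (⟨ 2 , 4 ⟩ ∷ ⟨ 1 , 0 ⟩ ∷ ⟨ 2 , 2 ⟩ ∷ ⟨ 1 , 1 ⟩ ∷ ⟨ 0 , 2 ⟩ ∷ ⟨ 1 , 3 ⟩ ∷ ⟨ 0 , 4 ⟩ ∷ ⟨ 1 , 2 ⟩ ∷ ⟨ 2 , 1 ⟩ ∷ []) ∷
  (⟨ 2 , 1 ⟩ ∷ ⟨ 1 , 3 ⟩ ∷ ⟨ 2 , 0 ⟩ ∷ ⟨ 1 , 2 ⟩ ∷ ⟨ 0 , 3 ⟩ ∷ ⟨ 1 , 0 ⟩ ∷ ⟨ 2 , 3 ⟩ ∷ ⟨ 1 , 4 ⟩ ∷ ⟨ 2 , 2 ⟩ ∷ []) ∷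
  (⟨ 2 , 2 ⟩ ∷ ⟨ 1 , 3 ⟩ ∷ ⟨ 0 , 1 ⟩ ∷ ⟨ 1 , 2 ⟩ ∷ ⟨ 2 , 4 ⟩ ∷ ⟨ 1 , 1 ⟩ ∷ ⟨ 2 , 0 ⟩ ∷ ⟨ 1 , 4 ⟩ ∷ ⟨ 0 , 0 ⟩ ∷ []) ∷ []

paths : Fin 5 → PathCopy 8 G
paths = pathCopies (λ a → lookup (lookup zigzags a)) _

mainTheorem7 : HasDecomposition 8 (Path 2 ⊗ Complete 5)
mainTheorem7 = 5 , 0 , pathDecomposition paths refl (from-yes (edgesUniquelyCovered? paths))
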